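{- Let $H$ be a bipartite graph in which all vertices of one part of the bipartition have degree at most $2$. Then there exists a constant $C$ such that the following holds. If $G$ is a bipartite graph with at least one edge, with bipartition $A\cup B$ where $n=|B|\geq |A|$ and $n\geq 2$, and, setting $M=C\log_2 n$, \[|\mathrm{Hom}(C_4,G)|\geq M\, |\mathrm{Hom}(K_{1,2},G)|,\] then $G$ contains a copy of $H$.
   Context: $\mathrm{Hom}(F,G)$ is the set of all homomorphisms from $F$ to $G$, i.e. maps $\phi:V(F)\to V(G)$ with $\phi(u)\phi(v)\in E(G)$ whenever $uv\in E(F)$. $K_{1,2}$ is the path with two edges (one centre vertex and two leaves); $\mathrm{Hom}(K_{1,2},G)$ counts all homomorphisms, with the centre mapped to either side. -}

module Defs where

open import Data.Nat using (ℕ; zero; suc; _+_; _≤_)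
open import Data.Bool using (Bool; true; false; T; if_then_else_)
open import Data.Fin using (Fin; zero; suc)
open import Data.List using (List; []; _∷_; [_]; map; concatMap; allFin; _++_)
open import Data.Nat.ListAction using (sum)
open import Data.Sum using (_⊎_; inj₁; inj₂)
open import Data.Product using (_×_; _,_; Σ; ∃-syntax)
open import Function.Definitions using (Injective)
open import Relation.Binary.PropositionalEquality using (_≡_)

record BipGraph : Set where
  field
    left  : ℕ
    right : ℕ
    adjLR : Fin left → Fin right → Bool
open BipGraph public

Vtx : BipGraph → Set
Vtx G = Fin (left G) ⊎ Fin (right G)

adj : (G : BipGraph) → Vtx G → Vtx G → Bool
adj G (inj₁ i) (inj₂ j) = adjLR G i j
adj G (inj₂ j) (inj₁ i) = adjLR G i j
adj G (inj₁ _) (inj₁ _) = false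
adj G (inj₂ _) (inj₂ _) = false

vertices : (G : BipGraph) → List (Vtx G)
vertices G = map inj₁ (allFin (left G)) ++ map inj₂ (allFin (right G))

-- all functions Fin k → V, given a complete duplicate-free list of V
allMaps : {V : Set} → List V → (k : ℕ) → List (Fin k → V)
allMaps vs zero = [ (λ ()) ]
allMaps vs (suc k) =
  concatMap (λ v → map (λ f → λ { zero → v ; (suc i) → f i }) (allMaps vs k)) vs

record Pattern : Set where
  field
    size  : ℕ
    edges : List (Fin size × Fin size)
open Pattern public

allB : {A : Set} → (A → Bool) → List A → Bool
allB p [] = true
allB p (x ∷ xs) = if p x then allB p xs else false

isHom : (F : Pattern) (G : BipGraph) → (Fin (size F) → Vtx G) → Bool
isHom F G φ = allB (λ { (u , v) → adj G (φ u) (φ v) }) (edges F)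

homCount : Pattern → BipGraph → ℕ
homCount F G =
  sum (map (λ φ → if isHom F G φ then 1 else 0) (allMaps (vertices G) (size F)))

C4 : Pattern
C4 = record { size = 4
            ; edges = (zero , suc zero) ∷ (suc zero , suc (suc zero))
                    ∷ (suc (suc zero) , suc (suc (suc zero)))
                    ∷ (suc (suc (suc zero)) , zero) ∷ [] }

K12 : Pattern
K12 = record { size = 3
             ; edges = (zero , suc zero) ∷ (zero , suc (suc zero)) ∷ [] }

degRight : (H : BipGraph) → Fin (right H) → ℕ
degRight H y = sum (map (λ x → if adjLR H x y then 1 else 0) (allFin (left H)))

HasEdge : BipGraph → Set
HasEdge G = Σ (Fin (left G)) λ i → Σ (Fin (right G)) λ j → T (adjLR G i j)

Contains : (G H : BipGraph) → Set
Contains G H = Σ (Vtx H → Vtx G) λ φ →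
  Injective _≡_ _≡_ φ × (∀ x y → T (adj H x y) → T (adj G (φ x) (φ y)))

-- Counting homomorphisms by the image of the centre, resp. of a pair of opposite vertices,
-- hom(K₁,₂, G) = Σ deg² and hom(C₄, G) = Σ codeg², each sum splitting over the two sides.
-- As n ≥ 2 the hypothesis gives hom(C₄) ≥ C · hom(K₁,₂), so on one side, say for pairs y, y′ ∈ B, Σ codeg(y, y′)² > M · hom(K₁,₂).
-- Dependent random choice, by averaging: Σ_{y,y′} |N(y) ∩ N(y′)| = Σ_A deg², and a pair
-- x, x′ ∈ A of codegree c < |B(H)| lies in c² of the sets N(y) ∩ N(y′), so some
-- U = N(y) ∩ N(y′) is large compared with the number of such bad pairs inside it.
-- Greedily, U then contains |A(H)| + 2 vertices of pairwise codegree ≥ |B(H)|. Embed A(H)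
-- into them; a vertex of B(H) has at most two neighbours, whose images have ≥ |B(H)| common
-- neighbours, which leaves room to send the vertices of B(H) to distinct ones.

module Submission where

open import Defs
open import Data.Nat hiding (_≟_)
open import Data.Nat.Properties hiding (_≟_)
open import Data.Nat.ListAction using (sum; product)
open import Data.Nat.ListAction.Properties using (sum-++)
open import Data.Nat.Tactic.RingSolver using (solve-∀)
open import Data.Bool using (Bool; true; false; T; if_then_else_; _∧_; _∨_; not)
open import Data.Bool.Properties using (T-∧; T-∨; T-≡)
open import Data.Fin using (Fin; zero; suc)
open import Data.Fin.Properties using (_≟_) renaming (suc-injective to Fin-suc-injective)
open import Data.List using (List; []; _∷_; _++_; map; concatMap; allFin; length; filter)
open import Data.Bool.ListAction using (any)
open import Data.List.Properties using (map-tabulate; map-++; length-tabulate)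
open import Data.List.Relation.Unary.All using ([]; _∷_)
open import Data.List.Relation.Unary.AllPairs using ([]; _∷_)
open import Data.List.Relation.Unary.Any using (here; there)
open import Data.List.Relation.Unary.Any.Properties using (any⁺)
open import Data.List.Relation.Unary.Unique.Propositional using (Unique)
open import Data.List.Relation.Unary.Unique.Propositional.Properties using (allFin⁺; filter⁺)
open import Data.List.Membership.Propositional using (_∈_; lose)
open import Data.List.Membership.Propositional.Properties using (∈-allFin; ∈-filter⁺)
open import Data.Product using (_×_; _,_; Σ-syntax; ∃-syntax; proj₁; proj₂)
open import Data.Sum using (_⊎_; inj₁; inj₂; swap; [_,_]′)
open import Data.Sum.Properties using (swap-involutive; inj₁-injective; inj₂-injective)
open import Data.Unit using (tt)
open import Data.Empty using (⊥-elim)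
open import Data.Vec.Functional using () renaming (_∷_ to _◂_)
open import Function using (_∘_; id)
open import Function.Bundles using (Equivalence)
open import Function.Definitions using (Injective)
open import Relation.Nullary using (¬_; Dec; yes; no; does)
open import Relation.Nullary.Decidable using (T?; dec-true)
open import Relation.Binary.PropositionalEquality
open import Algebra.Properties.CommutativeSemigroup +-commutativeSemigroup using (interchange)

-- Finite sums and counting

⟦_⟧ : Bool → ℕ
⟦ b ⟧ = if b then 1 else 0

∑ : {A : Set} → List A → (A → ℕ) → ℕ
∑ xs f = sum (map f xs)

infixr 6.5 ∑
syntax ∑ xs (λ x → e) = ∑[ x ∈ xs ] e

count : {n : ℕ} → (Fin n → Bool) → ℕ
count {n} p = ∑[ x ∈ allFin n ] ⟦ p x ⟧

T-does : {A : Set} (d : Dec A) → A → T (does d)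
T-does d a = Equivalence.from T-≡ (dec-true d a)

⟦∧⟧ : (a b : Bool) → ⟦ a ∧ b ⟧ ≡ ⟦ a ⟧ * ⟦ b ⟧
⟦∧⟧ true  b = sym (+-identityʳ ⟦ b ⟧)
⟦∧⟧ false b = refl

⟦∨⟧≤ : (a b : Bool) → ⟦ a ∨ b ⟧ ≤ ⟦ a ⟧ + ⟦ b ⟧
⟦∨⟧≤ true  b = s≤s z≤n
⟦∨⟧≤ false b = ≤-refl

⟦⟧<⟦⟧ : (a b : Bool) → ⟦ a ⟧ < ⟦ b ⟧ → ¬ T a × T b
⟦⟧<⟦⟧ false true  _ = (λ ()) , tt
⟦⟧<⟦⟧ true  true  (s≤s ())
⟦⟧<⟦⟧ _     false ()

module _ {A : Set} where

  ∑-cong : (xs : List A) {f g : A → ℕ} → (∀ x → f x ≡ g x) → ∑ xs f ≡ ∑ xs g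
  ∑-cong []       f≗g = refl
  ∑-cong (x ∷ xs) f≗g = cong₂ _+_ (f≗g x) (∑-cong xs f≗g)

  ∑-mono : (xs : List A) {f g : A → ℕ} → (∀ x → f x ≤ g x) → ∑ xs f ≤ ∑ xs g
  ∑-mono []       f≤g = z≤n
  ∑-mono (x ∷ xs) f≤g = +-mono-≤ (f≤g x) (∑-mono xs f≤g)

  ∑-zero : (xs : List A) → ∑[ x ∈ xs ] 0 ≡ 0
  ∑-zero []       = refl
  ∑-zero (x ∷ xs) = ∑-zero xs

  ∑-const : (xs : List A) (c : ℕ) → ∑[ x ∈ xs ] c ≡ length xs * c
  ∑-const []       c = refl
  ∑-const (x ∷ xs) c = cong (c +_) (∑-const xs c)

  ∑-distrib-+ : (xs : List A) (f g : A → ℕ) → ∑[ x ∈ xs ] (f x + g x) ≡ ∑ xs f + ∑ xs g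
  ∑-distrib-+ []       f g = refl
  ∑-distrib-+ (x ∷ xs) f g =
    trans (cong (f x + g x +_) (∑-distrib-+ xs f g)) (interchange (f x) (g x) (∑ xs f) (∑ xs g))

  ∑-*ˡ : (xs : List A) (k : ℕ) (f : A → ℕ) → ∑[ x ∈ xs ] k * f x ≡ k * ∑ xs f
  ∑-*ˡ []       k f = sym (*-zeroʳ k)
  ∑-*ˡ (x ∷ xs) k f = trans (cong (k * f x +_) (∑-*ˡ xs k f)) (sym (*-distribˡ-+ k (f x) (∑ xs f)))

  ∑-*ʳ : (xs : List A) (k : ℕ) (f : A → ℕ) → ∑[ x ∈ xs ] f x * k ≡ ∑ xs f * k
  ∑-*ʳ xs k f = trans (∑-cong xs (λ x → *-comm (f x) k)) (trans (∑-*ˡ xs k f) (*-comm k _))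

  ∑-++ : (xs ys : List A) (f : A → ℕ) → ∑ (xs ++ ys) f ≡ ∑ xs f + ∑ ys f
  ∑-++ xs ys f = trans (cong sum (map-++ f xs ys)) (sum-++ (map f xs) (map f ys))

  ∈⇒≤∑ : {xs : List A} {x : A} (f : A → ℕ) → x ∈ xs → f x ≤ ∑ xs f
  ∈⇒≤∑ f (here refl)  = m≤m+n _ _
  ∈⇒≤∑ f (there x∈xs) = ≤-trans (∈⇒≤∑ f x∈xs) (m≤n+m _ _)

  ∑<∑⇒∃< : (xs : List A) (f g : A → ℕ) → ∑ xs f < ∑ xs g → ∃[ x ] f x < g x
  ∑<∑⇒∃< (x ∷ xs) f g lt with f x <? g x
  ... | yes fx<gx = x , fx<gx
  ... | no  fx≮gx = ∑<∑⇒∃< xs f g (+-cancelˡ-< (g x) _ _ (≤-<-trans (+-monoˡ-≤ _ (≮⇒≥ fx≮gx)) lt))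

  ⟦any⟧≤∑ : (p : A → Bool) (xs : List A) → ⟦ any p xs ⟧ ≤ ∑[ x ∈ xs ] ⟦ p x ⟧
  ⟦any⟧≤∑ p []       = z≤n
  ⟦any⟧≤∑ p (x ∷ xs) = ≤-trans (⟦∨⟧≤ (p x) _) (+-monoʳ-≤ ⟦ p x ⟧ (⟦any⟧≤∑ p xs))

  ¬any⇒¬ : (p : A → Bool) {xs : List A} → ¬ T (any p xs) → {x : A} → x ∈ xs → ¬ T (p x)
  ¬any⇒¬ p ¬any x∈xs px = ¬any (any⁺ p (lose x∈xs px))

  count≡length-filter : (p : A → Bool) (xs : List A) →
    ∑[ x ∈ xs ] ⟦ p x ⟧ ≡ length (filter (T? ∘ p) xs)
  count≡length-filter p [] = refl
  count≡length-filter p (x ∷ xs) with p x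
  ... | true  = cong suc (count≡length-filter p xs)
  ... | false = count≡length-filter p xs

module _ {A B : Set} where

  ∑-map : (xs : List A) (h : A → B) (f : B → ℕ) → ∑ (map h xs) f ≡ ∑[ x ∈ xs ] f (h x)
  ∑-map []       h f = refl
  ∑-map (x ∷ xs) h f = cong (f (h x) +_) (∑-map xs h f)

  ∑-comm : (xs : List A) (ys : List B) (f : A → B → ℕ) →
    ∑[ x ∈ xs ] ∑[ y ∈ ys ] f x y ≡ ∑[ y ∈ ys ] ∑[ x ∈ xs ] f x y
  ∑-comm []       ys f = sym (∑-zero ys)
  ∑-comm (x ∷ xs) ys f =
    trans (cong (∑ ys (f x) +_) (∑-comm xs ys f)) (sym (∑-distrib-+ ys (f x) (λ y → ∑[ x ∈ xs ] f x y)))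

  ∑*∑ : (xs : List A) (ys : List B) (f : A → ℕ) (g : B → ℕ) →
    ∑ xs f * ∑ ys g ≡ ∑[ x ∈ xs ] ∑[ y ∈ ys ] f x * g y
  ∑*∑ xs ys f g = begin
    ∑ xs f * ∑ ys g                   ≡⟨ *-comm (∑ xs f) _ ⟩
    ∑ ys g * ∑ xs f                   ≡⟨ ∑-*ˡ xs (∑ ys g) f ⟨
    ∑[ x ∈ xs ] ∑ ys g * f x          ≡⟨ ∑-cong xs (λ x → trans (*-comm _ (f x)) (sym (∑-*ˡ ys (f x) g))) ⟩
    ∑[ x ∈ xs ] ∑[ y ∈ ys ] f x * g y ∎
    where open ≡-Reasoning

∑-concatMap : {A B : Set} (xs : List A) (g : A → List B) (f : B → ℕ) →
  ∑ (concatMap g xs) f ≡ ∑[ x ∈ xs ] ∑ (g x) f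
∑-concatMap []       g f = refl
∑-concatMap (x ∷ xs) g f = trans (∑-++ (g x) _ f) (cong (∑ (g x) f +_) (∑-concatMap xs g f))

∑-concatMap-map : {A B C : Set} (xs : List A) (ys : List B) (h : A → B → C) (f : C → ℕ) →
  ∑ (concatMap (λ x → map (h x) ys) xs) f ≡ ∑[ x ∈ xs ] ∑[ y ∈ ys ] f (h x y)
∑-concatMap-map xs ys h f = trans (∑-concatMap xs _ f) (∑-cong xs (λ x → ∑-map ys (h x) f))

∑∑-comm : {A B : Set} (xs : List A) (ys : List B) (f : A → A → B → B → ℕ) →
  ∑[ x ∈ xs ] ∑[ x′ ∈ xs ] ∑[ y ∈ ys ] ∑[ y′ ∈ ys ] f x x′ y y′ ≡
  ∑[ y ∈ ys ] ∑[ y′ ∈ ys ] ∑[ x ∈ xs ] ∑[ x′ ∈ xs ] f x x′ y y′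
∑∑-comm xs ys f = trans
  (∑-cong xs (λ x → trans (∑-comm xs ys _) (∑-cong ys (λ y → ∑-comm xs ys _))))
  (trans (∑-comm xs ys _) (∑-cong ys (λ y → ∑-comm xs ys _)))

∑-allFin-suc : {n : ℕ} (f : Fin (suc n) → ℕ) →
  ∑[ x ∈ allFin (suc n) ] f x ≡ f zero + (∑[ x ∈ allFin n ] f (suc x))
∑-allFin-suc f = cong (f zero +_) (cong sum (trans (map-tabulate suc f) (sym (map-tabulate id (f ∘ suc)))))

∑-allFin-const : (n c : ℕ) → ∑[ x ∈ allFin n ] c ≡ n * c
∑-allFin-const n c = trans (∑-const (allFin n) c) (cong (_* c) (length-tabulate {n = n} id))

count-≟ : {n : ℕ} (x : Fin n) → count (λ y → does (x ≟ y)) ≡ 1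
count-≟ {suc n} zero    = trans (∑-allFin-suc {n} (λ y → ⟦ does (zero ≟ y) ⟧)) (cong suc (∑-zero (allFin n)))
count-≟ {suc n} (suc x) = trans (∑-allFin-suc {n} (λ y → ⟦ does (suc x ≟ y) ⟧)) (count-≟ x)

count<count⇒∃ : {n : ℕ} (avoid want : Fin n → Bool) → count avoid < count want →
  ∃[ x ] ¬ T (avoid x) × T (want x)
count<count⇒∃ {n} avoid want lt with ∑<∑⇒∃< (allFin n) _ _ lt
... | x , lt-x = x , ⟦⟧<⟦⟧ (avoid x) (want x) lt-x

◂-injective : {n k : ℕ} {x : Fin n} {w : Fin k → Fin n} →
  (∀ t → w t ≢ x) → Injective _≡_ _≡_ w → Injective _≡_ _≡_ (x ◂ w)
◂-injective w≢x w-inj {zero}  {zero}  eq = refl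
◂-injective w≢x w-inj {zero}  {suc u} eq = ⊥-elim (w≢x u (sym eq))
◂-injective w≢x w-inj {suc t} {zero}  eq = ⊥-elim (w≢x t eq)
◂-injective w≢x w-inj {suc t} {suc u} eq = cong suc (w-inj eq)

-- Greedy constructions

inImage : {k n : ℕ} → (Fin k → Fin n) → Fin n → Bool
inImage {k} β y = any (λ t → does (β t ≟ y)) (allFin k)

count-inImage≤ : {k n : ℕ} (β : Fin k → Fin n) → count (inImage β) ≤ k
count-inImage≤ {k} {n} β = begin
  count (inImage β)                                      ≤⟨ ∑-mono (allFin n) (λ y → ⟦any⟧≤∑ _ (allFin k)) ⟩
  ∑[ y ∈ allFin n ] ∑[ t ∈ allFin k ] ⟦ does (β t ≟ y) ⟧ ≡⟨ ∑-comm (allFin n) (allFin k) _ ⟩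
  ∑[ t ∈ allFin k ] count (λ y → does (β t ≟ y))         ≡⟨ ∑-cong (allFin k) (count-≟ ∘ β) ⟩
  ∑[ t ∈ allFin k ] 1                                    ≡⟨ ∑-allFin-const k 1 ⟩
  k * 1                                                  ≡⟨ *-identityʳ k ⟩
  k                                                      ∎
  where open ≤-Reasoning

¬inImage⇒≢ : {k n : ℕ} (β : Fin k → Fin n) {y : Fin n} → ¬ T (inImage β y) → ∀ t → β t ≢ y
¬inImage⇒≢ β {y} ¬hit t eq = ¬any⇒¬ (λ t → does (β t ≟ y)) ¬hit (∈-allFin t) (T-does (β t ≟ y) eq)

distinctRepresentatives : {n : ℕ} (k : ℕ) (P : Fin k → Fin n → Bool) → (∀ t → k ≤ count (P t)) →
  Σ[ β ∈ (Fin k → Fin n) ] Injective _≡_ _≡_ β × (∀ t → T (P t (β t)))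
distinctRepresentatives zero    P large = (λ ()) , (λ {}) , (λ ())
distinctRepresentatives (suc k) P large
  with β , β-inj , β-ok ← distinctRepresentatives k (P ∘ suc) (λ t → ≤-trans (n≤1+n k) (large (suc t)))
  with y , ¬hit , Py ← count<count⇒∃ (inImage β) (P zero) (≤-<-trans (count-inImage≤ β) (large zero))
  = (y ◂ β) , ◂-injective (¬inImage⇒≢ β ¬hit) β-inj , λ { zero → Py ; (suc t) → β-ok t }

module _ {a : ℕ} (U : Fin a → Bool) (bad : Fin a → Fin a → Bool) where

  badDeg : Fin a → ℕ
  badDeg x = count (λ x′ → U x′ ∧ bad x x′)

  badPairs : ℕ
  badPairs = ∑[ x ∈ allFin a ] ⟦ U x ⟧ * badDeg x

  -- Call x light if it has fewer than |U| / 2s bad partners in U. The hypothesis makes light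
  -- vertices a majority of U and |U| > 2s², so the fewer than k (1 + |U| / 2s) vertices blocked
  -- by k < s chosen light ones cannot exhaust the light vertices.
  module _ (bad-sym : ∀ x x′ → bad x x′ ≡ bad x′ x) (s : ℕ)
           (few : 2 * (2 * s) * badPairs + 2 * s * s * count U < count U * count U) where

    private
      N : ℕ
      N = count U

      isLight isHeavy : Fin a → Bool
      isLight x = U x ∧ (2 * s * badDeg x <ᵇ N)
      isHeavy x = U x ∧ not (2 * s * badDeg x <ᵇ N)

      N-large : 2 * s * s < N
      N-large = *-cancelʳ-< N _ _ (≤-<-trans (m≤n+m _ _) few)

      light+heavy : N ≡ count isLight + count isHeavy
      light+heavy = trans (∑-cong (allFin a) (λ x → split (U x) _)) (∑-distrib-+ (allFin a) _ _)
        where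
        split : (u l : Bool) → ⟦ u ⟧ ≡ ⟦ u ∧ l ⟧ + ⟦ u ∧ not l ⟧
        split true  true  = refl
        split true  false = refl
        split false _     = refl

      heavy*N≤ : count isHeavy * N ≤ 2 * s * badPairs
      heavy*N≤ = begin
        count isHeavy * N                         ≡⟨ ∑-*ʳ (allFin a) N _ ⟨
        ∑[ x ∈ allFin a ] ⟦ isHeavy x ⟧ * N        ≤⟨ ∑-mono (allFin a) (λ x → heavy (U x) (badDeg x)) ⟩
        ∑[ x ∈ allFin a ] 2 * s * (⟦ U x ⟧ * badDeg x) ≡⟨ ∑-*ˡ (allFin a) (2 * s) _ ⟩
        2 * s * badPairs                          ∎
        where
        open ≤-Reasoning
        heavy : (u : Bool) (b : ℕ) → ⟦ u ∧ not (2 * s * b <ᵇ N) ⟧ * N ≤ 2 * s * (⟦ u ⟧ * b)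
        heavy false b = z≤n
        heavy true  b with 2 * s * b <ᵇ N in eq
        ... | true  = z≤n
        ... | false rewrite +-identityʳ N | +-identityʳ b = ≮⇒≥ (λ lt → subst T eq (<⇒<ᵇ lt))

      lightMajority : N < 2 * count isLight
      lightMajority = begin-strict
        N                                 ≡⟨ light+heavy ⟩
        count isLight + count isHeavy     <⟨ +-monoʳ-< (count isLight) heavy<light ⟩
        count isLight + count isLight     ≡⟨ cong (count isLight +_) (+-identityʳ _) ⟨
        2 * count isLight                 ∎
        where
        open ≤-Reasoning
        2heavy<N : 2 * count isHeavy < N
        2heavy<N = *-cancelʳ-< N _ _ (begin-strict
          2 * count isHeavy * N          ≡⟨ *-assoc 2 (count isHeavy) N ⟩
          2 * (count isHeavy * N)        ≤⟨ *-monoʳ-≤ 2 heavy*N≤ ⟩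
          2 * (2 * s * badPairs)         ≡⟨ *-assoc 2 (2 * s) badPairs ⟨
          2 * (2 * s) * badPairs         ≤⟨ m≤m+n _ _ ⟩
          2 * (2 * s) * badPairs + 2 * s * s * N <⟨ few ⟩
          N * N                          ∎)
        heavy<light : count isHeavy < count isLight
        heavy<light = +-cancelʳ-< (count isHeavy) _ _
          (subst₂ _<_ (cong (count isHeavy +_) (+-identityʳ _)) light+heavy 2heavy<N)

      blocked : {k : ℕ} → (Fin k → Fin a) → Fin a → Bool
      blocked {k} w x = any (λ t → does (w t ≟ x) ∨ (U x ∧ bad (w t) x)) (allFin k)

      count-blocked≤ : {k : ℕ} (w : Fin k → Fin a) → count (blocked w) ≤ ∑[ t ∈ allFin k ] (1 + badDeg (w t))
      count-blocked≤ {k} w = begin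
        count (blocked w)
          ≤⟨ ∑-mono (allFin a) (λ x → ⟦any⟧≤∑ _ (allFin k)) ⟩
        (∑[ x ∈ allFin a ] ∑[ t ∈ allFin k ] ⟦ does (w t ≟ x) ∨ (U x ∧ bad (w t) x) ⟧)
          ≤⟨ ∑-mono (allFin a) (λ x → ∑-mono (allFin k) (λ t → ⟦∨⟧≤ (does (w t ≟ x)) _)) ⟩
        (∑[ x ∈ allFin a ] ∑[ t ∈ allFin k ] (⟦ does (w t ≟ x) ⟧ + ⟦ U x ∧ bad (w t) x ⟧))
          ≡⟨ ∑-comm (allFin a) (allFin k) _ ⟩
        (∑[ t ∈ allFin k ] ∑[ x ∈ allFin a ] (⟦ does (w t ≟ x) ⟧ + ⟦ U x ∧ bad (w t) x ⟧))
          ≡⟨ ∑-cong (allFin k) (λ t → trans (∑-distrib-+ (allFin a) _ _) (cong (_+ badDeg (w t)) (count-≟ (w t)))) ⟩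
        (∑[ t ∈ allFin k ] (1 + badDeg (w t))) ∎
        where open ≤-Reasoning

      blocked<light : {k : ℕ} (w : Fin k → Fin a) → k < s → (∀ t → T (isLight (w t))) →
        count (blocked w) < count isLight
      blocked<light {k} w k<s w-light = *-cancelˡ-< (2 * s) _ _ (begin-strict
        2 * s * count (blocked w)                       ≤⟨ *-monoʳ-≤ (2 * s) (count-blocked≤ w) ⟩
        2 * s * (∑[ t ∈ allFin k ] (1 + badDeg (w t)))  ≡⟨ ∑-*ˡ (allFin k) (2 * s) _ ⟨
        (∑[ t ∈ allFin k ] 2 * s * (1 + badDeg (w t)))  ≤⟨ ∑-mono (allFin k) (light-cost ∘ w-light) ⟩
        (∑[ t ∈ allFin k ] (2 * s + N))                 ≡⟨ ∑-allFin-const k _ ⟩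
        k * (2 * s + N)                                 <⟨ budget ⟩
        s * N                                           <⟨ *-monoʳ-< s {{>-nonZero (≤-<-trans z≤n k<s)}} lightMajority ⟩
        s * (2 * count isLight)                         ≡⟨ *-assoc s 2 _ ⟨
        s * 2 * count isLight                           ≡⟨ cong (_* count isLight) (*-comm s 2) ⟩
        2 * s * count isLight                           ∎)
        where
        open ≤-Reasoning
        budget : k * (2 * s + N) < s * N
        budget = begin-strict
          k * (2 * s + N)       ≡⟨ *-distribˡ-+ k (2 * s) N ⟩
          k * (2 * s) + k * N   ≤⟨ +-monoˡ-≤ (k * N) (*-monoˡ-≤ (2 * s) (<⇒≤ k<s)) ⟩
          s * (2 * s) + k * N   ≡⟨ cong (_+ k * N) (*-comm s (2 * s)) ⟩
          2 * s * s + k * N     <⟨ +-monoˡ-< (k * N) N-large ⟩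
          N + k * N             ≤⟨ *-monoˡ-≤ N k<s ⟩
          s * N                 ∎
        light-cost : {x : Fin a} → T (isLight x) → 2 * s * (1 + badDeg x) ≤ 2 * s + N
        light-cost {x} light = begin
          2 * s * (1 + badDeg x)        ≡⟨ *-distribˡ-+ (2 * s) 1 (badDeg x) ⟩
          2 * s * 1 + 2 * s * badDeg x  ≤⟨ +-mono-≤ (≤-reflexive (*-identityʳ (2 * s)))
                                                    (<⇒≤ (<ᵇ⇒< _ _ (proj₂ (Equivalence.to T-∧ light)))) ⟩
          2 * s + N                     ∎

      unblocked : {k : ℕ} (w : Fin k → Fin a) {x : Fin a} → ¬ T (blocked w x) → T (U x) →
        ∀ t → w t ≢ x × ¬ T (bad (w t) x)
      unblocked w {x} ¬blocked Ux t =
        (λ eq → clear (Equivalence.from T-∨ (inj₁ (T-does (w t ≟ x) eq)))) ,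
        (λ wt-x-bad → clear (Equivalence.from T-∨ (inj₂ (Equivalence.from T-∧ (Ux , wt-x-bad)))))
        where
        clear : ¬ T (does (w t ≟ x) ∨ (U x ∧ bad (w t) x))
        clear = ¬any⇒¬ _ ¬blocked (∈-allFin t)

      Clique : {k : ℕ} → (Fin k → Fin a) → Set
      Clique w = (∀ t → T (isLight (w t))) × Injective _≡_ _≡_ w × (∀ t t′ → t ≢ t′ → ¬ T (bad (w t) (w t′)))

      extend : {k : ℕ} (w : Fin k → Fin a) → k < s → Clique w → Σ[ x ∈ Fin a ] Clique (x ◂ w)
      extend w k<s (w-light , w-inj , w-good) with count<count⇒∃ (blocked w) isLight (blocked<light w k<s w-light)
      ... | x , ¬blocked , x-light = x , light′ , ◂-injective (proj₁ ∘ clear) w-inj , good′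
        where
        clear : ∀ t → w t ≢ x × ¬ T (bad (w t) x)
        clear = unblocked w ¬blocked (proj₁ (Equivalence.to T-∧ x-light))
        light′ : ∀ t → T (isLight ((x ◂ w) t))
        light′ zero    = x-light
        light′ (suc t) = w-light t
        good′ : ∀ t t′ → t ≢ t′ → ¬ T (bad ((x ◂ w) t) ((x ◂ w) t′))
        good′ zero    zero     t≢t′ = ⊥-elim (t≢t′ refl)
        good′ zero    (suc t′) _    = subst (¬_ ∘ T) (bad-sym (w t′) x) (proj₂ (clear t′))
        good′ (suc t) zero     _    = proj₂ (clear t)
        good′ (suc t) (suc t′) t≢t′ = w-good t t′ (t≢t′ ∘ cong suc)

      clique : (k : ℕ) → k ≤ s → Σ[ w ∈ (Fin k → Fin a) ] Clique w
      clique zero    _   = (λ ()) , (λ ()) , (λ {}) , (λ ())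
      clique (suc k) k<s with w , w-clique ← clique k (<⇒≤ k<s) with x , x◂w-clique ← extend w k<s w-clique =
        (x ◂ w) , x◂w-clique

    fewBadPairs⇒clique :
      Σ[ w ∈ (Fin s → Fin a) ] Injective _≡_ _≡_ w × (∀ t t′ → t ≢ t′ → ¬ T (bad (w t) (w t′)))
    fewBadPairs⇒clique with w , _ , w-inj , w-good ← clique s ≤-refl = w , w-inj , w-good

-- Homomorphism counts

⟦allB⟧ : {A : Set} (p : A → Bool) (xs : List A) → ⟦ allB p xs ⟧ ≡ product (map (⟦_⟧ ∘ p) xs)
⟦allB⟧ p []       = refl
⟦allB⟧ p (x ∷ xs) with p x
... | true  = trans (⟦allB⟧ p xs) (sym (+-identityʳ _))
... | false = refl

module _ (G : BipGraph) where

  adjℕ : Vtx G → Vtx G → ℕ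
  adjℕ u v = ⟦ adj G u v ⟧

  adj-sym : ∀ u v → adj G u v ≡ adj G v u
  adj-sym (inj₁ _) (inj₁ _) = refl
  adj-sym (inj₁ _) (inj₂ _) = refl
  adj-sym (inj₂ _) (inj₁ _) = refl
  adj-sym (inj₂ _) (inj₂ _) = refl

  deg : Vtx G → ℕ
  deg u = ∑[ v ∈ vertices G ] adjℕ u v

  codeg : Vtx G → Vtx G → ℕ
  codeg u v = ∑[ w ∈ vertices G ] adjℕ u w * adjℕ w v

  private
    V : List (Vtx G)
    V = vertices G

  ⟦isHom⟧ : (F : Pattern) (φ : Fin (size F) → Vtx G) →
    ⟦ isHom F G φ ⟧ ≡ product (map (λ e → adjℕ (φ (proj₁ e)) (φ (proj₂ e))) (edges F))
  ⟦isHom⟧ F φ = ⟦allB⟧ _ (edges F)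

  homCount-K12 : homCount K12 G ≡ ∑[ u ∈ V ] deg u * deg u
  homCount-K12 = begin
    homCount K12 G
      ≡⟨ trans (∑-concatMap-map V (allMaps V 2) _ _) (∑-cong V λ u →
         trans (∑-concatMap-map V (allMaps V 1) _ _) (∑-cong V λ v →
         trans (∑-concatMap V _ _) (∑-cong V λ w →
         trans (+-identityʳ _) (trans (⟦isHom⟧ K12 (u ◂ (v ◂ (w ◂ λ ())))) (cong (adjℕ u v *_) (*-identityʳ _)))))) ⟩
    (∑[ u ∈ V ] ∑[ v ∈ V ] ∑[ w ∈ V ] adjℕ u v * adjℕ u w)
      ≡⟨ ∑-cong V (λ u → sym (∑*∑ V V (adjℕ u) (adjℕ u))) ⟩
    (∑[ u ∈ V ] deg u * deg u) ∎
    where open ≡-Reasoning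

  homCount-C4 : homCount C4 G ≡ ∑[ u ∈ V ] ∑[ w ∈ V ] codeg u w * codeg u w
  homCount-C4 = begin
    homCount C4 G
      ≡⟨ trans (∑-concatMap-map V (allMaps V 3) _ _) (∑-cong V λ u →
         trans (∑-concatMap-map V (allMaps V 2) _ _) (∑-cong V λ v →
         trans (∑-concatMap-map V (allMaps V 1) _ _) (∑-cong V λ w →
         trans (∑-concatMap V _ _) (∑-cong V λ x →
         trans (+-identityʳ _) (⟦isHom⟧ C4 (u ◂ (v ◂ (w ◂ (x ◂ λ ()))))))))) ⟩
    (∑[ u ∈ V ] ∑[ v ∈ V ] ∑[ w ∈ V ] ∑[ x ∈ V ] cycle u v w x)
      ≡⟨ ∑-cong V (λ u → ∑-comm V V _) ⟩
    (∑[ u ∈ V ] ∑[ w ∈ V ] ∑[ v ∈ V ] ∑[ x ∈ V ] cycle u v w x)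
      ≡⟨ ∑-cong V (λ u → ∑-cong V λ w → ∑-cong V λ v → ∑-cong V λ x → cycle≡ u v w x) ⟩
    (∑[ u ∈ V ] ∑[ w ∈ V ] ∑[ v ∈ V ] ∑[ x ∈ V ] (adjℕ u v * adjℕ v w) * (adjℕ u x * adjℕ x w))
      ≡⟨ ∑-cong V (λ u → ∑-cong V λ w → sym (∑*∑ V V _ _)) ⟩
    (∑[ u ∈ V ] ∑[ w ∈ V ] codeg u w * codeg u w) ∎
    where
    open ≡-Reasoning
    cycle : Vtx G → Vtx G → Vtx G → Vtx G → ℕ
    cycle u v w x = adjℕ u v * (adjℕ v w * (adjℕ w x * (adjℕ x u * 1)))
    reorder : ∀ a b c d → a * (b * (c * (d * 1))) ≡ (a * b) * (d * c)
    reorder = solve-∀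
    cycle≡ : ∀ u v w x → cycle u v w x ≡ (adjℕ u v * adjℕ v w) * (adjℕ u x * adjℕ x w)
    cycle≡ u v w x rewrite adj-sym w x | adj-sym x u = reorder (adjℕ u v) (adjℕ v w) (adjℕ x w) (adjℕ u x)

_ᵀ : BipGraph → BipGraph
G ᵀ = record { left = right G ; right = left G ; adjLR = λ j i → adjLR G i j }

Contains-trans : {G F H : BipGraph} → Contains G F → Contains F H → Contains G H
Contains-trans (φ , φ-inj , φ-hom) (ψ , ψ-inj , ψ-hom) =
  φ ∘ ψ , ψ-inj ∘ φ-inj , λ x y → φ-hom (ψ x) (ψ y) ∘ ψ-hom x y

Contains-ᵀ : (G : BipGraph) → Contains G (G ᵀ)
Contains-ᵀ G = swap , swap-injective , hom
  where
  swap-injective : Injective _≡_ _≡_ swap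
  swap-injective {u} {v} eq = trans (sym (swap-involutive u)) (trans (cong swap eq) (swap-involutive v))
  hom : ∀ u v → T (adj (G ᵀ) u v) → T (adj G (swap u) (swap v))
  hom (inj₁ _) (inj₂ _) e = e
  hom (inj₂ _) (inj₁ _) e = e

degL : (G : BipGraph) → Fin (left G) → ℕ
degL G x = ∑[ y ∈ allFin (right G) ] ⟦ adjLR G x y ⟧

codegL : (G : BipGraph) → Fin (left G) → Fin (left G) → ℕ
codegL G x x′ = ∑[ y ∈ allFin (right G) ] ⟦ adjLR G x y ⟧ * ⟦ adjLR G x′ y ⟧

sumDegSq : BipGraph → ℕ
sumDegSq G = ∑[ x ∈ allFin (left G) ] degL G x * degL G x

sumCodegSq : BipGraph → ℕ
sumCodegSq G = ∑[ x ∈ allFin (left G) ] ∑[ x′ ∈ allFin (left G) ] codegL G x x′ * codegL G x x′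

module _ (G : BipGraph) where

  private
    L : List (Fin (left G))
    L = allFin (left G)
    R : List (Fin (right G))
    R = allFin (right G)

  ∑-vertices : (f : Vtx G → ℕ) → ∑ (vertices G) f ≡ ∑[ x ∈ L ] f (inj₁ x) + ∑[ y ∈ R ] f (inj₂ y)
  ∑-vertices f = trans (∑-++ (map inj₁ L) (map inj₂ R) f) (cong₂ _+_ (∑-map L inj₁ f) (∑-map R inj₂ f))

  codegL-sym : ∀ x x′ → codegL G x x′ ≡ codegL G x′ x
  codegL-sym x x′ = ∑-cong R (λ y → *-comm ⟦ adjLR G x y ⟧ _)

  ∑codegL≡sumDegSqᵀ : ∑[ x ∈ L ] ∑[ x′ ∈ L ] codegL G x x′ ≡ sumDegSq (G ᵀ)
  ∑codegL≡sumDegSqᵀ = begin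
    (∑[ x ∈ L ] ∑[ x′ ∈ L ] ∑[ y ∈ R ] ⟦ adjLR G x y ⟧ * ⟦ adjLR G x′ y ⟧)
      ≡⟨ ∑-cong L (λ x → ∑-comm L R _) ⟩
    (∑[ x ∈ L ] ∑[ y ∈ R ] ∑[ x′ ∈ L ] ⟦ adjLR G x y ⟧ * ⟦ adjLR G x′ y ⟧)
      ≡⟨ ∑-comm L R _ ⟩
    (∑[ y ∈ R ] ∑[ x ∈ L ] ∑[ x′ ∈ L ] ⟦ adjLR G x y ⟧ * ⟦ adjLR G x′ y ⟧)
      ≡⟨ ∑-cong R (λ y → sym (∑*∑ L L _ _)) ⟩
    sumDegSq (G ᵀ) ∎
    where open ≡-Reasoning

  sumDegSq-pos : HasEdge G → 1 ≤ sumDegSq G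
  sumDegSq-pos (x , y , xy) = begin
    1                    ≤⟨ *-mono-≤ 1≤degL 1≤degL ⟩
    degL G x * degL G x  ≤⟨ ∈⇒≤∑ (λ x → degL G x * degL G x) (∈-allFin x) ⟩
    sumDegSq G           ∎
    where
    open ≤-Reasoning
    1≤degL : 1 ≤ degL G x
    1≤degL = subst (_≤ degL G x) (cong ⟦_⟧ (Equivalence.to T-≡ xy)) (∈⇒≤∑ (λ y → ⟦ adjLR G x y ⟧) (∈-allFin y))

  homCount-K12-bip : homCount K12 G ≡ sumDegSq G + sumDegSq (G ᵀ)
  homCount-K12-bip = trans (homCount-K12 G) (trans (∑-vertices _)
    (cong₂ _+_ (∑-cong L λ x → cong (λ d → d * d) (deg-inj₁ x))
               (∑-cong R λ y → cong (λ d → d * d) (deg-inj₂ y))))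
    where
    deg-inj₁ : ∀ x → deg G (inj₁ x) ≡ degL G x
    deg-inj₁ x = trans (∑-vertices _) (cong (_+ degL G x) (∑-zero L))
    deg-inj₂ : ∀ y → deg G (inj₂ y) ≡ degL (G ᵀ) y
    deg-inj₂ y = trans (∑-vertices _) (trans (cong (degL (G ᵀ) y +_) (∑-zero R)) (+-identityʳ _))

  homCount-C4-bip : homCount C4 G ≡ sumCodegSq G + sumCodegSq (G ᵀ)
  homCount-C4-bip = trans (homCount-C4 G) (trans (∑-vertices _) (cong₂ _+_ (∑-cong L row₁) (∑-cong R row₂)))
    where
    sq : ℕ → ℕ
    sq c = c * c
    codeg₁₁ : ∀ x x′ → codeg G (inj₁ x) (inj₁ x′) ≡ codegL G x x′
    codeg₁₁ x x′ = trans (∑-vertices _) (cong (_+ codegL G x x′) (∑-zero L))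
    codeg₁₂ : ∀ x y → codeg G (inj₁ x) (inj₂ y) ≡ 0
    codeg₁₂ x y = trans (∑-vertices _) (cong₂ _+_ (∑-zero L) (trans (∑-cong R λ z → *-zeroʳ ⟦ adjLR G x z ⟧) (∑-zero R)))
    codeg₂₁ : ∀ y x → codeg G (inj₂ y) (inj₁ x) ≡ 0
    codeg₂₁ y x = trans (∑-vertices _) (cong₂ _+_ (trans (∑-cong L λ z → *-zeroʳ ⟦ adjLR G z y ⟧) (∑-zero L)) (∑-zero R))
    codeg₂₂ : ∀ y y′ → codeg G (inj₂ y) (inj₂ y′) ≡ codegL (G ᵀ) y y′
    codeg₂₂ y y′ = trans (∑-vertices _) (trans (cong (codegL (G ᵀ) y y′ +_) (∑-zero R)) (+-identityʳ _))
    row₁ : ∀ x → ∑[ w ∈ vertices G ] sq (codeg G (inj₁ x) w) ≡ ∑[ x′ ∈ L ] sq (codegL G x x′)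
    row₁ x = trans (∑-vertices _) (trans
      (cong₂ _+_ (∑-cong L λ x′ → cong sq (codeg₁₁ x x′)) (trans (∑-cong R λ y → cong sq (codeg₁₂ x y)) (∑-zero R)))
      (+-identityʳ _))
    row₂ : ∀ y → ∑[ w ∈ vertices G ] sq (codeg G (inj₂ y) w) ≡ ∑[ y′ ∈ R ] sq (codegL (G ᵀ) y y′)
    row₂ y = trans (∑-vertices _)
      (cong₂ _+_ (trans (∑-cong L λ x → cong sq (codeg₂₁ y x)) (∑-zero L)) (∑-cong R λ y′ → cong sq (codeg₂₂ y y′)))

-- Embedding H

-- Positions 0 and 1 of Fin (2 + s) are spares, padding neighbourhoods of size below two.
anchorPair : {s : ℕ} (ns : List (Fin s)) → Unique ns → length ns ≤ 2 →
  Σ[ p ∈ Fin (2 + s) ] Σ[ q ∈ Fin (2 + s) ] p ≢ q × (∀ {i} → i ∈ ns → p ≡ suc (suc i) ⊎ q ≡ suc (suc i))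
anchorPair []                _                   _ = zero , suc zero , (λ ()) , λ ()
anchorPair (i ∷ [])          _                   _ = suc (suc i) , zero , (λ ()) , λ { (here refl) → inj₁ refl }
anchorPair (i ∷ j ∷ [])      ((i≢j ∷ []) ∷ _)    _ =
  suc (suc i) , suc (suc j) , (i≢j ∘ Fin-suc-injective ∘ Fin-suc-injective) ,
  λ { (here refl) → inj₁ refl ; (there (here refl)) → inj₂ refl }
anchorPair (_ ∷ _ ∷ _ ∷ _)   _  (s≤s (s≤s ()))

codegreeClique⇒Contains : (H G : BipGraph) → (∀ j → degRight H j ≤ 2) →
  (w : Fin (2 + left H) → Fin (left G)) → Injective _≡_ _≡_ w →
  (∀ t t′ → t ≢ t′ → right H ≤ codegL G (w t) (w t′)) → Contains G H
codegreeClique⇒Contains H G deg≤2 w w-inj w-codeg = φ , φ-inj , φ-hom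
  where
  neighbours : Fin (right H) → List (Fin (left H))
  neighbours j = filter (λ i → T? (adjLR H i j)) (allFin (left H))

  anchors : ∀ j → Σ[ p ∈ Fin (2 + left H) ] Σ[ q ∈ Fin (2 + left H) ]
    p ≢ q × (∀ {i} → i ∈ neighbours j → p ≡ suc (suc i) ⊎ q ≡ suc (suc i))
  anchors j = anchorPair (neighbours j) (filter⁺ _ (allFin⁺ (left H)))
    (subst (_≤ 2) (count≡length-filter (λ i → adjLR H i j) (allFin (left H))) (deg≤2 j))

  p q : Fin (right H) → Fin (2 + left H)
  p j = proj₁ (anchors j)
  q j = proj₁ (proj₂ (anchors j))

  commonNeighbour : Fin (right H) → Fin (right G) → Bool
  commonNeighbour j y = adjLR G (w (p j)) y ∧ adjLR G (w (q j)) y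

  choice : Σ[ β ∈ (Fin (right H) → Fin (right G)) ]
    Injective _≡_ _≡_ β × (∀ j → T (commonNeighbour j (β j)))
  choice = distinctRepresentatives (right H) commonNeighbour λ j →
    subst (right H ≤_) (sym (∑-cong (allFin (right G)) (λ y → ⟦∧⟧ (adjLR G (w (p j)) y) _)))
      (w-codeg (p j) (q j) (proj₁ (proj₂ (proj₂ (anchors j)))))

  β : Fin (right H) → Fin (right G)
  β = proj₁ choice

  φ : Vtx H → Vtx G
  φ (inj₁ i) = inj₁ (w (suc (suc i)))
  φ (inj₂ j) = inj₂ (β j)

  φ-inj : Injective _≡_ _≡_ φ
  φ-inj {inj₁ i} {inj₁ i′} eq = cong inj₁ (Fin-suc-injective (Fin-suc-injective (w-inj (inj₁-injective eq))))
  φ-inj {inj₂ j} {inj₂ j′} eq = cong inj₂ (proj₁ (proj₂ choice) (inj₂-injective eq))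
  φ-inj {inj₁ _} {inj₂ _} ()
  φ-inj {inj₂ _} {inj₁ _} ()

  edge : ∀ i j → T (adjLR H i j) → T (adjLR G (w (suc (suc i))) (β j))
  edge i j ij with proj₂ (proj₂ (proj₂ (anchors j))) (∈-filter⁺ _ (∈-allFin i) ij)
                 | Equivalence.to T-∧ (proj₂ (proj₂ choice) j)
  ... | inj₁ p≡ | pβ , _ = subst (λ t → T (adjLR G (w t) (β j))) p≡ pβ
  ... | inj₂ q≡ | _ , qβ = subst (λ t → T (adjLR G (w t) (β j))) q≡ qβ

  φ-hom : ∀ u v → T (adj H u v) → T (adj G (φ u) (φ v))
  φ-hom (inj₁ i) (inj₂ j) = edge i j
  φ-hom (inj₂ j) (inj₁ i) = edge i j

-- Dependent random choice

⟦<ᵇ⟧*sq≤ : (c r : ℕ) → ⟦ c <ᵇ r ⟧ * (c * c) ≤ r * c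
⟦<ᵇ⟧*sq≤ c r with c <ᵇ r in eq
... | false = z≤n
... | true rewrite +-identityʳ (c * c) = *-monoˡ-≤ c (<⇒≤ (<ᵇ⇒< c r (subst T (sym eq) tt)))

drcThreshold : ℕ → ℕ → ℕ
drcThreshold s r = 2 * (2 * s) * r + 2 * s * s

module _ (G : BipGraph) where

  private
    L : List (Fin (left G))
    L = allFin (left G)
    R : List (Fin (right G))
    R = allFin (right G)

  commonNeighbourhood : Fin (right G) → Fin (right G) → Fin (left G) → Bool
  commonNeighbourhood y y′ x = adjLR G x y ∧ adjLR G x y′

  lowCodeg : ℕ → Fin (left G) → Fin (left G) → Bool
  lowCodeg r x x′ = codegL G x x′ <ᵇ r

  lowCodeg-sym : ∀ r x x′ → lowCodeg r x x′ ≡ lowCodeg r x′ x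
  lowCodeg-sym r x x′ = cong (_<ᵇ r) (codegL-sym G x x′)

  count-commonNeighbourhood : ∀ y y′ → count (commonNeighbourhood y y′) ≡ codegL (G ᵀ) y y′
  count-commonNeighbourhood y y′ = ∑-cong L (λ x → ⟦∧⟧ (adjLR G x y) _)

  ∑count-commonNeighbourhood : ∑[ y ∈ R ] ∑[ y′ ∈ R ] count (commonNeighbourhood y y′) ≡ sumDegSq G
  ∑count-commonNeighbourhood =
    trans (∑-cong R λ y → ∑-cong R λ y′ → count-commonNeighbourhood y y′) (∑codegL≡sumDegSqᵀ (G ᵀ))

  ∑count²-commonNeighbourhood :
    ∑[ y ∈ R ] ∑[ y′ ∈ R ] count (commonNeighbourhood y y′) * count (commonNeighbourhood y y′)
      ≡ sumCodegSq (G ᵀ)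
  ∑count²-commonNeighbourhood =
    ∑-cong R λ y → ∑-cong R λ y′ → cong (λ c → c * c) (count-commonNeighbourhood y y′)

  -- A pair x, x′ lies in the common neighbourhood of exactly codegL G x x′ ² pairs y, y′.
  ∑badPairs≤ : (r : ℕ) →
    ∑[ y ∈ R ] ∑[ y′ ∈ R ] badPairs (commonNeighbourhood y y′) (lowCodeg r) ≤ r * sumDegSq (G ᵀ)
  ∑badPairs≤ r = begin
    (∑[ y ∈ R ] ∑[ y′ ∈ R ] ∑[ x ∈ L ] ⟦ U y y′ x ⟧ * count (λ x′ → U y y′ x′ ∧ bad x x′))
      ≡⟨ ∑-cong R (λ y → ∑-cong R λ y′ → ∑-cong L λ x →
           trans (sym (∑-*ˡ L ⟦ U y y′ x ⟧ _)) (∑-cong L λ x′ → term x x′ y y′)) ⟩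
    (∑[ y ∈ R ] ∑[ y′ ∈ R ] ∑[ x ∈ L ] ∑[ x′ ∈ L ] weight x x′ y y′)
      ≡⟨ ∑∑-comm L R weight ⟨
    (∑[ x ∈ L ] ∑[ x′ ∈ L ] ∑[ y ∈ R ] ∑[ y′ ∈ R ] weight x x′ y y′)
      ≡⟨ ∑-cong L (λ x → ∑-cong L λ x′ → trans (∑-cong R λ y → ∑-*ˡ R ⟦ bad x x′ ⟧ _)
           (trans (∑-*ˡ R ⟦ bad x x′ ⟧ _) (cong (⟦ bad x x′ ⟧ *_) (sym (∑*∑ R R _ _))))) ⟩
    (∑[ x ∈ L ] ∑[ x′ ∈ L ] ⟦ bad x x′ ⟧ * (codegL G x x′ * codegL G x x′))
      ≤⟨ ∑-mono L (λ x → ∑-mono L λ x′ → ⟦<ᵇ⟧*sq≤ (codegL G x x′) r) ⟩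
    (∑[ x ∈ L ] ∑[ x′ ∈ L ] r * codegL G x x′)
      ≡⟨ trans (∑-cong L λ x → ∑-*ˡ L r _) (∑-*ˡ L r _) ⟩
    r * (∑[ x ∈ L ] ∑[ x′ ∈ L ] codegL G x x′)
      ≡⟨ cong (r *_) (∑codegL≡sumDegSqᵀ G) ⟩
    r * sumDegSq (G ᵀ) ∎
    where
    open ≤-Reasoning
    U : Fin (right G) → Fin (right G) → Fin (left G) → Bool
    U = commonNeighbourhood
    bad : Fin (left G) → Fin (left G) → Bool
    bad = lowCodeg r
    a : Fin (left G) → Fin (right G) → ℕ
    a x y = ⟦ adjLR G x y ⟧
    weight : Fin (left G) → Fin (left G) → Fin (right G) → Fin (right G) → ℕ
    weight x x′ y y′ = ⟦ bad x x′ ⟧ * ((a x y * a x′ y) * (a x y′ * a x′ y′))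
    rearrange : ∀ p q p′ q′ b → p * q * (p′ * q′ * b) ≡ b * (p * p′ * (q * q′))
    rearrange = solve-∀
    term : ∀ x x′ y y′ → ⟦ U y y′ x ⟧ * ⟦ U y y′ x′ ∧ bad x x′ ⟧ ≡ weight x x′ y y′
    term x x′ y y′ = trans
      (cong₂ _*_ (⟦∧⟧ (adjLR G x y) _) (trans (⟦∧⟧ (U y y′ x′) _) (cong (_* ⟦ bad x x′ ⟧) (⟦∧⟧ (adjLR G x′ y) _))))
      (rearrange (a x y) (a x y′) (a x′ y) (a x′ y′) ⟦ bad x x′ ⟧)

  ∑cost≤ : (s r : ℕ) →
    ∑[ y ∈ R ] ∑[ y′ ∈ R ] (2 * (2 * s) * badPairs (commonNeighbourhood y y′) (lowCodeg r)
                             + 2 * s * s * count (commonNeighbourhood y y′))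
      ≤ drcThreshold s r * (sumDegSq G + sumDegSq (G ᵀ))
  ∑cost≤ s r = begin
    (∑[ y ∈ R ] ∑[ y′ ∈ R ] (A * nBad y y′ + B * nCommon y y′))
      ≡⟨ trans (∑-cong R λ y → linear (nBad y) (nCommon y)) (linear _ _) ⟩
    A * (∑[ y ∈ R ] ∑[ y′ ∈ R ] nBad y y′) + B * (∑[ y ∈ R ] ∑[ y′ ∈ R ] nCommon y y′)
      ≤⟨ +-mono-≤ (*-monoʳ-≤ A (∑badPairs≤ r)) (≤-reflexive (cong (B *_) ∑count-commonNeighbourhood)) ⟩
    A * (r * sumDegSq (G ᵀ)) + B * sumDegSq G
      ≤⟨ subst (A * (r * sumDegSq (G ᵀ)) + B * sumDegSq G ≤_)
               (expand A r B (sumDegSq G) (sumDegSq (G ᵀ))) (m≤m+n _ _) ⟩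
    drcThreshold s r * (sumDegSq G + sumDegSq (G ᵀ)) ∎
    where
    open ≤-Reasoning
    A B : ℕ
    A = 2 * (2 * s)
    B = 2 * s * s
    nBad nCommon : Fin (right G) → Fin (right G) → ℕ
    nBad y y′ = badPairs (commonNeighbourhood y y′) (lowCodeg r)
    nCommon y y′ = count (commonNeighbourhood y y′)
    linear : (f g : Fin (right G) → ℕ) → ∑[ y ∈ R ] (A * f y + B * g y) ≡ A * ∑ R f + B * ∑ R g
    linear f g = trans (∑-distrib-+ R _ _) (cong₂ _+_ (∑-*ˡ R A f) (∑-*ˡ R B g))
    expand : ∀ a r b x y → a * (r * y) + b * x + (a * r * x + b * y) ≡ (a * r + b) * (x + y)
    expand = solve-∀

  manyCodegreeSquares⇒sparsePair : (s r : ℕ) →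
    drcThreshold s r * (sumDegSq G + sumDegSq (G ᵀ)) < sumCodegSq (G ᵀ) →
    Σ[ y ∈ Fin (right G) ] Σ[ y′ ∈ Fin (right G) ]
      2 * (2 * s) * badPairs (commonNeighbourhood y y′) (lowCodeg r) + 2 * s * s * count (commonNeighbourhood y y′)
        < count (commonNeighbourhood y y′) * count (commonNeighbourhood y y′)
  manyCodegreeSquares⇒sparsePair s r many
    with y , y-sparse ← ∑<∑⇒∃< R _ _
      (<-≤-trans (≤-<-trans (∑cost≤ s r) many) (≤-reflexive (sym ∑count²-commonNeighbourhood)))
    = y , ∑<∑⇒∃< R _ _ y-sparse

manyCodegreeSquares⇒Contains : (H : BipGraph) → (∀ j → degRight H j ≤ 2) → (G : BipGraph) →
  drcThreshold (2 + left H) (right H) * (sumDegSq G + sumDegSq (G ᵀ)) < sumCodegSq (G ᵀ) → Contains G H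
manyCodegreeSquares⇒Contains H deg≤2 G many = fromPair (manyCodegreeSquares⇒sparsePair G s r many)
  where
  s r : ℕ
  s = 2 + left H
  r = right H
  U : Fin (right G) → Fin (right G) → Fin (left G) → Bool
  U = commonNeighbourhood G
  fromClique : Σ[ w ∈ (Fin s → Fin (left G)) ] Injective _≡_ _≡_ w ×
                 (∀ t t′ → t ≢ t′ → ¬ T (lowCodeg G r (w t) (w t′))) → Contains G H
  fromClique (w , w-inj , w-good) = codegreeClique⇒Contains H G deg≤2 w w-inj
    (λ t t′ t≢t′ → ≮⇒≥ (w-good t t′ t≢t′ ∘ <⇒<ᵇ {codegL G (w t) (w t′)} {r}))
  fromPair : Σ[ y ∈ Fin (right G) ] Σ[ y′ ∈ Fin (right G) ]
               2 * (2 * s) * badPairs (U y y′) (lowCodeg G r) + 2 * s * s * count (U y y′)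
                 < count (U y y′) * count (U y y′) → Contains G H
  fromPair (y , y′ , sparse) = fromClique (fewBadPairs⇒clique (U y y′) (lowCodeg G r) (lowCodeg-sym G r) s sparse)

exponent-≤ : {m a b : ℕ} → 2 ≤ m → m ^ a ≤ 2 ^ b → a ≤ b
exponent-≤ {m} {a} {b} 2≤m m^a≤2^b = ≮⇒≥ λ b<a →
  <-irrefl refl (<-≤-trans (^-monoʳ-< 2 (s≤s (s≤s z≤n)) b<a) (≤-trans (^-monoˡ-≤ a 2≤m) m^a≤2^b))

m+m<a+b⇒m<a⊎m<b : {m a b : ℕ} → m + m < a + b → m < a ⊎ m < b
m+m<a+b⇒m<a⊎m<b {m} {a} {b} lt with m <? a
... | yes m<a = inj₁ m<a
... | no  m≮a = inj₂ (+-cancelˡ-< m _ _ (<-≤-trans lt (+-monoˡ-≤ b (≮⇒≥ m≮a))))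

lemma3p2 : (H : BipGraph) → (∀ y → degRight H y ≤ 2) →
    ∃[ C ] ((G : BipGraph) → HasEdge G → left G ≤ right G → 2 ≤ right G →
      right G ^ (C * homCount K12 G) ≤ 2 ^ homCount C4 G →
      Contains G H)
lemma3p2 H deg≤2 = suc (2 * M) , containsH
  where
  M : ℕ
  M = drcThreshold (2 + left H) (right H)
  containsH : (G : BipGraph) → HasEdge G → left G ≤ right G → 2 ≤ right G →
    right G ^ (suc (2 * M) * homCount K12 G) ≤ 2 ^ homCount C4 G → Contains G H
  containsH G edge _ 2≤n hom-bound =
    [ (λ many → Contains-trans (Contains-ᵀ G) (manyCodegreeSquares⇒Contains H deg≤2 (G ᵀ)
                  (subst (λ k → M * k < sumCodegSq G) (+-comm (sumDegSq G) _) many)))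
    , manyCodegreeSquares⇒Contains H deg≤2 G
    ]′ (m+m<a+b⇒m<a⊎m<b manyC4)
    where
    K : ℕ
    K = sumDegSq G + sumDegSq (G ᵀ)
    manyC4 : M * K + M * K < sumCodegSq G + sumCodegSq (G ᵀ)
    manyC4 = begin-strict
      M * K + M * K                  ≡⟨ double M K ⟩
      2 * M * K                      <⟨ m<n+m _ (≤-trans (sumDegSq-pos G edge) (m≤m+n _ _)) ⟩
      suc (2 * M) * K                ≡⟨ cong (suc (2 * M) *_) (homCount-K12-bip G) ⟨
      suc (2 * M) * homCount K12 G   ≤⟨ exponent-≤ 2≤n hom-bound ⟩
      homCount C4 G                  ≡⟨ homCount-C4-bip G ⟩
      sumCodegSq G + sumCodegSq (G ᵀ) ∎
      where
      open ≤-Reasoning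
      double : ∀ m k → m * k + m * k ≡ 2 * m * k
      double = solve-∀
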